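{- Work in $\mathsf{CZF}^-$. Let $A\in B$ be sets with $\mathcal P(1)\cap A=\mathcal P(1)\cap B$, where $A$ is BCST-regular and $B$ is a transitive model of $\mathsf{CZF}^-$. Let $a\in A$, let $R\in B$ with $R:a\rightrightarrows A$, and let $Q\subseteq a\times A$ with $Q\in B$. Writing $Q_x=\{y\mid\langle x,y\rangle\in Q\}$, assume (i) $\langle x,y\rangle\in R$ implies $y\subseteq Q_x$, and (ii) (monotone closedness) $\langle x,y\rangle\in R$ and $y\subseteq z\subseteq Q_x$ imply $\langle x,z\rangle\in R$. Then there is $f\in A\cap{}^aA$ such that $\langle x,f(x)\rangle\in R$ for all $x\in a$.
   Context: $\mathsf{CZF}^-$: intuitionistic Extensionality, Pairing, Union, Emptyset, Replacement, $\Delta_0$-Separation, Infinity, $\in$-induction, Strong Collection. $1=\{0\}$. $R:a\rightrightarrows C$ means $\forall x\in a\exists y\in C\,\langle x,y\rangle\in R$; $R:a\leftrightarrows b$ means $R:a\rightrightarrows b$ and $\forall y\in b\exists x\in a\,\langle x,y\rangle\in R$. A transitive set $A$ is regular if for all $a\in A$ and all classes $R$ with $R:a\rightrightarrows A$ there is $b\in A$ with $R:a\leftrightarrows b$; it is BCST-regular if moreover $(A,\in)$ satisfies Extensionality, Pairing, Union, Emptyset, Replacement and $\Delta_0$-Separation. ${}^aA$ is the class of functions from $a$ to $A$. -}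

module Defs where

open import Data.Nat using (ℕ; suc)
open import Data.Fin using (Fin)
open import Data.Product using (Σ; _×_; _,_)
open import Data.Sum using (_⊎_)
open import Data.Empty using (⊥)
open import Data.Unit using (⊤)
open import Relation.Nullary using (¬_)
open import Data.Vec.Functional using (Vector; _∷_)

infix 2 _iff_
_iff_ : Set → Set → Set
P iff Q = (P → Q) × (Q → P)

record Structure : Set₁ where
  infix 4 _∈_ _≈_
  field
    V     : Set
    _∈_   : V → V → Set
    _≈_   : V → V → Set
    ≈-refl  : ∀ {x} → x ≈ x
    ≈-sym   : ∀ {x y} → x ≈ y → y ≈ x
    ≈-trans : ∀ {x y z} → x ≈ y → y ≈ z → x ≈ z
    ∈-congˡ : ∀ {x y z} → x ≈ y → x ∈ z → y ∈ z
    ∈-congʳ : ∀ {x y z} → x ≈ y → z ∈ x → z ∈ y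

-- First-order formulas with n free variables (de Bruijn, variable 0 is
-- the most recently bound one).  Used to express axiom schemes and
-- (definable) classes.

data Fm (n : ℕ) : Set where
  mem eq         : Fin n → Fin n → Fm n
  ff             : Fm n
  and or imp     : Fm n → Fm n → Fm n
  all ex         : Fm (suc n) → Fm n
  ball bex       : Fin n → Fm (suc n) → Fm n

data Δ₀ {n : ℕ} : Fm n → Set where
  mem  : ∀ i j → Δ₀ (mem i j)
  eq   : ∀ i j → Δ₀ (eq i j)
  ff   : Δ₀ ff
  and  : ∀ {φ ψ} → Δ₀ φ → Δ₀ ψ → Δ₀ (and φ ψ)
  or   : ∀ {φ ψ} → Δ₀ φ → Δ₀ ψ → Δ₀ (or φ ψ)
  imp  : ∀ {φ ψ} → Δ₀ φ → Δ₀ ψ → Δ₀ (imp φ ψ)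
  ball : ∀ i {φ} → Δ₀ φ → Δ₀ (ball i φ)
  bex  : ∀ i {φ} → Δ₀ φ → Δ₀ (bex i φ)

module _ (S : Structure) where
  open Structure S

  Sat : (M : V → Set) → ∀ {n} → Fm n → Vector V n → Set
  Sat M (mem i j) ρ = ρ i ∈ ρ j
  Sat M (eq i j)  ρ = ρ i ≈ ρ j
  Sat M ff        ρ = ⊥
  Sat M (and φ ψ) ρ = Sat M φ ρ × Sat M ψ ρ
  Sat M (or φ ψ)  ρ = Sat M φ ρ ⊎ Sat M ψ ρ
  Sat M (imp φ ψ) ρ = Sat M φ ρ → Sat M ψ ρ
  Sat M (all φ)   ρ = (x : V) → M x → Sat M φ (x ∷ ρ)
  Sat M (ex φ)    ρ = Σ V λ x → M x × Sat M φ (x ∷ ρ)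
  Sat M (ball i φ) ρ = (x : V) → M x → x ∈ ρ i → Sat M φ (x ∷ ρ)
  Sat M (bex i φ)  ρ = Σ V λ x → M x × (x ∈ ρ i × Sat M φ (x ∷ ρ))

  AllIn : (M : V → Set) → ∀ {n} → Vector V n → Set
  AllIn M ρ = ∀ i → M (ρ i)

  Extensionality : (V → Set) → Set
  Extensionality M = (a b : V) → M a → M b →
    ((z : V) → M z → (z ∈ a iff z ∈ b)) → a ≈ b

  Pairing : (V → Set) → Set
  Pairing M = (a b : V) → M a → M b → Σ V λ c → M c ×
    ((y : V) → M y → (y ∈ c iff (y ≈ a ⊎ y ≈ b)))

  Union : (V → Set) → Set
  Union M = (a : V) → M a → Σ V λ u → M u ×
    ((y : V) → M y → (y ∈ u iff (Σ V λ x → M x × (x ∈ a × y ∈ x))))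

  Emptyset : (V → Set) → Set
  Emptyset M = Σ V λ e → M e × ((y : V) → M y → ¬ (y ∈ e))

  -- φ(x, y, params) : variable 0 is y, variable 1 is x
  Replacement : (V → Set) → Set
  Replacement M = ∀ {n} (φ : Fm (suc (suc n))) (ρ : Vector V n) → AllIn M ρ →
    (a : V) → M a →
    ((x : V) → M x → x ∈ a → Σ V λ y → M y × (Sat M φ (y ∷ x ∷ ρ) ×
        ((y′ : V) → M y′ → Sat M φ (y′ ∷ x ∷ ρ) → y′ ≈ y))) →
    Σ V λ b → M b × ((y : V) → M y →
      (y ∈ b iff (Σ V λ x → M x × (x ∈ a × Sat M φ (y ∷ x ∷ ρ)))))

  Δ₀-Separation : (V → Set) → Set
  Δ₀-Separation M = ∀ {n} (φ : Fm (suc n)) → Δ₀ φ → (ρ : Vector V n) → AllIn M ρ →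
    (a : V) → M a → Σ V λ b → M b × ((x : V) → M x →
      (x ∈ b iff (x ∈ a × Sat M φ (x ∷ ρ))))

  Infinity : (V → Set) → Set
  Infinity M = Σ V λ a → M a × ((Σ V λ x → M x × x ∈ a) ×
    ((x : V) → M x → x ∈ a → Σ V λ y → M y × (y ∈ a × x ∈ y)))

  ∈-Induction : (V → Set) → Set
  ∈-Induction M = ∀ {n} (φ : Fm (suc n)) (ρ : Vector V n) → AllIn M ρ →
    ((a : V) → M a → ((x : V) → M x → x ∈ a → Sat M φ (x ∷ ρ)) → Sat M φ (a ∷ ρ)) →
    (a : V) → M a → Sat M φ (a ∷ ρ)

  StrongCollection : (V → Set) → Set
  StrongCollection M = ∀ {n} (φ : Fm (suc (suc n))) (ρ : Vector V n) → AllIn M ρ →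
    (a : V) → M a →
    ((x : V) → M x → x ∈ a → Σ V λ y → M y × Sat M φ (y ∷ x ∷ ρ)) →
    Σ V λ b → M b ×
      (((x : V) → M x → x ∈ a → Σ V λ y → M y × (y ∈ b × Sat M φ (y ∷ x ∷ ρ))) ×
       ((y : V) → M y → y ∈ b → Σ V λ x → M x × (x ∈ a × Sat M φ (y ∷ x ∷ ρ))))

  BCSTAxioms : (V → Set) → Set
  BCSTAxioms M = (Extensionality M × Pairing M × Union M × Emptyset M) ×
            (Replacement M × Δ₀-Separation M)

  CZF⁻ : (V → Set) → Set
  CZF⁻ M = ((Extensionality M × Pairing M × Union M × Emptyset M × Infinity M) ×
            (Replacement M × Δ₀-Separation M × ∈-Induction M × StrongCollection M))

  Universe : V → Set
  Universe _ = ⊤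

  _⊆_ : V → V → Set
  x ⊆ y = (z : V) → z ∈ x → z ∈ y

  IsTransitive : V → Set
  IsTransitive A = (x : V) → x ∈ A → x ⊆ A

  IsEmpty : V → Set
  IsEmpty z = (w : V) → ¬ (w ∈ z)

  _∈1 : V → Set
  z ∈1 = IsEmpty z

  ⊆1 : V → Set
  ⊆1 x = (z : V) → z ∈ x → z ∈1

  -- Kuratowski ordered pair  p = ⟨x,y⟩ = {{x},{x,y}}
  IsPair : V → V → V → Set
  IsPair p x y = (z : V) → z ∈ p iff
    (((w : V) → w ∈ z iff w ≈ x) ⊎ ((w : V) → w ∈ z iff (w ≈ x ⊎ w ≈ y)))

  ⟨_,_⟩∈ : V → V → (V → Set) → Set
  ⟨ x , y ⟩∈ R = Σ V λ p → IsPair p x y × R p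

  _∶_⇉_ : (V → Set) → V → V → Set
  R ∶ a ⇉ C = (x : V) → x ∈ a → Σ V λ y → y ∈ C × ⟨ x , y ⟩∈ R

  _∶_⇆_ : (V → Set) → V → V → Set
  R ∶ a ⇆ b = R ∶ a ⇉ b × ((y : V) → y ∈ b → Σ V λ x → x ∈ a × ⟨ x , y ⟩∈ R)

  ⟦_⟧_ : ∀ {n} → Fm (suc n) → Vector V n → V → Set
  (⟦ φ ⟧ ρ) z = Sat Universe φ (z ∷ ρ)

  mem[_] : V → V → Set
  mem[ R ] z = z ∈ R

  -- A is regular (A assumed transitive separately); classes R are
  -- definable classes with arbitrary parameters
  IsRegular : V → Set
  IsRegular A = IsTransitive A ×
    ((a : V) → a ∈ A → ∀ {n} (φ : Fm (suc n)) (ρ : Vector V n) →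
      (⟦ φ ⟧ ρ) ∶ a ⇉ A → Σ V λ b → b ∈ A × (⟦ φ ⟧ ρ) ∶ a ⇆ b)

  IsBCSTRegular : V → Set
  IsBCSTRegular A = IsRegular A × BCSTAxioms mem[ A ]

  IsTransitiveModelOfCZF⁻ : V → Set
  IsTransitiveModelOfCZF⁻ B = IsTransitive B × CZF⁻ mem[ B ]

  ⊆× : V → V → V → Set
  ⊆× Q a A = (q : V) → q ∈ Q → Σ V λ x → x ∈ a × Σ V λ y → y ∈ A × IsPair q x y

  IsFunction : V → V → V → Set
  IsFunction f a A = ⊆× f a A ×
    (((x : V) → x ∈ a → Σ V λ y → ⟨ x , y ⟩∈ mem[ f ]) ×
     ((x y y′ : V) → ⟨ x , y ⟩∈ mem[ f ] → ⟨ x , y′ ⟩∈ mem[ f ] → y ≈ y′))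

{-# OPTIONS --safe #-}
-- Regularity of A gives b ∈ A with R : a ⇉ b. For x ∈ a let z be the union of all y ∈ b with
-- ⟨x,y⟩ ∈ R: by (i) z ⊆ Q_x, and z contains an R-value of x, so ⟨x,z⟩ ∈ R by (ii).
-- To see z ∈ A, form the truth value t = {0 ∣ ⟨x,y⟩ ∈ R} in B by Δ₀-separation; as t ⊆ 1 it lies
-- in A, and separating y by "t is inhabited" inside A yields {v ∈ y ∣ ⟨x,y⟩ ∈ R} ∈ A. Regularity
-- collects these sets over b into some c ∈ A, and z = ⋃ c. A last use of regularity collects the
-- pairs ⟨x,z⟩ into f ∈ A, which is single-valued because z is determined by x.
module Submission where

open import Data.Nat using (ℕ)
open import Data.Fin using (Fin; zero; suc; #_)
open import Data.Product using (Σ; _×_; _,_; proj₁; proj₂)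
open import Data.Sum using (_⊎_; inj₁; inj₂; reduce) renaming (map to ⊎-map)
open import Data.Unit using (⊤; tt)
open import Data.Vec.Functional using (Vector; _∷_; [])
open import Defs

module _ {P P′ Q Q′ : Set} where

  _×-iff_ : P iff P′ → Q iff Q′ → (P × Q) iff (P′ × Q′)
  (f , g) ×-iff (h , k) = (λ (p , q) → f p , h q) , (λ (p , q) → g p , k q)

  _⊎-iff_ : P iff P′ → Q iff Q′ → (P ⊎ Q) iff (P′ ⊎ Q′)
  (f , g) ⊎-iff (h , k) = ⊎-map f h , ⊎-map g k

  _⇔-iff_ : P iff P′ → Q iff Q′ → (P iff Q) iff (P′ iff Q′)
  (f , g) ⇔-iff (h , k) = (λ (l , r) → (λ p → h (l (g p))) , (λ q → f (r (k q))))
                        , (λ (l , r) → (λ p → k (l (f p))) , (λ q → g (r (h q))))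

iff-refl : ∀ {P : Set} → P iff P
iff-refl = (λ p → p) , (λ p → p)

iff-sym : ∀ {P Q : Set} → P iff Q → Q iff P
iff-sym (f , g) = g , f

iff-trans : ∀ {P Q R : Set} → P iff Q → Q iff R → P iff R
iff-trans (f , g) (h , k) = (λ p → h (f p)) , (λ r → g (k r))

module _ {X : Set} {P Q : X → Set} where

  ∀-iff : (∀ x → P x iff Q x) → (∀ x → P x) iff (∀ x → Q x)
  ∀-iff h = (λ p x → proj₁ (h x) (p x)) , (λ q x → proj₂ (h x) (q x))

  ∀⊤-iff : (∀ x → P x iff Q x) → (∀ x → ⊤ → P x) iff (∀ x → Q x)
  ∀⊤-iff h = (λ p x → proj₁ (h x) (p x tt)) , (λ q x _ → proj₂ (h x) (q x))

  Σ-iff : (∀ x → P x iff Q x) → Σ X P iff Σ X Q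
  Σ-iff h = (λ (x , p) → x , proj₁ (h x) p) , (λ (x , q) → x , proj₂ (h x) q)

  Σ⊤-iff : (∀ x → P x iff Q x) → (Σ X λ x → ⊤ × P x) iff Σ X Q
  Σ⊤-iff h = (λ (x , _ , p) → x , proj₁ (h x) p) , (λ (x , q) → x , tt , proj₂ (h x) q)

_⇔ᶠ_ : ∀ {n} → Fm n → Fm n → Fm n
φ ⇔ᶠ ψ = and (imp φ ψ) (imp ψ φ)

isPairᶠ : ∀ {n} → Fin n → Fin n → Fin n → Fm n
isPairᶠ p x y = all (mem zero (suc p) ⇔ᶠ or (all (mem zero (suc zero) ⇔ᶠ eq zero x″))
                                             (all (mem zero (suc zero) ⇔ᶠ or (eq zero x″) (eq zero y″))))
  where
  x″ = suc (suc x)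
  y″ = suc (suc y)

pairMemᶠ : ∀ {n} → Fin n → Fin n → Fin n → Fm n
pairMemᶠ r x y = ex (and (isPairᶠ zero (suc x) (suc y)) (mem zero (suc r)))

module SetTheory (S : Structure) where
  open Structure S

  IsSingleton : V → V → Set
  IsSingleton c x = (w : V) → w ∈ c iff w ≈ x

  IsUnorderedPair : V → V → V → Set
  IsUnorderedPair c x y = (w : V) → w ∈ c iff (w ≈ x ⊎ w ≈ y)

  Inhabited : V → Set
  Inhabited x = Σ V λ e → e ∈ x

  IsSep : V → Set → V → Set
  IsSep y P u = (v : V) → v ∈ u iff (v ∈ y × P)

  IsUnionOf : (V → Set) → V → Set
  IsUnionOf P z = (w : V) → w ∈ z iff Σ V λ y → P y × w ∈ y

  GraphOf : (V → V → Set) → V → Set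
  GraphOf φ p = Σ V λ x → Σ V λ y → IsPair S p x y × φ x y

  Respects₂ : (V → V → Set) → Set
  Respects₂ φ = ∀ {x x′ y y′} → x ≈ x′ → y ≈ y′ → φ x y → φ x′ y′

  sat-isPairᶠ : ∀ {n} (p x y : Fin n) (ρ : Vector V n) →
    Sat S (Universe S) (isPairᶠ p x y) ρ iff IsPair S (ρ p) (ρ x) (ρ y)
  sat-isPairᶠ p x y ρ = ∀⊤-iff λ z → iff-refl ⇔-iff (∀⊤-iff (λ w → iff-refl) ⊎-iff ∀⊤-iff (λ w → iff-refl))

  sat-pairMemᶠ : ∀ {n} (r x y : Fin n) (ρ : Vector V n) →
    Sat S (Universe S) (pairMemᶠ r x y) ρ iff ⟨_,_⟩∈ S (ρ x) (ρ y) (_∈ ρ r)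
  sat-pairMemᶠ r x y ρ = Σ⊤-iff λ q → sat-isPairᶠ zero (suc x) (suc y) (q ∷ ρ) ×-iff iff-refl

  Definable : (V → Set) → Set
  Definable P = Σ ℕ λ n → Σ (Fm (ℕ.suc n)) λ φ → Σ (Vector V n) λ ρ → (p : V) → ⟦_⟧_ S φ ρ p iff P p

  mem-definable : (R : V) → Definable (_∈ R)
  mem-definable R = 1 , mem (# 0) (# 1) , R ∷ [] , λ _ → iff-refl

  pairMember-map : ∀ {x y} {P P′ : V → Set} → (∀ p → P p → P′ p) → ⟨_,_⟩∈ S x y P → ⟨_,_⟩∈ S x y P′
  pairMember-map P⇒P′ (q , q-pair , qP) = q , q-pair , P⇒P′ q qP

  ⇉-map : ∀ {P P′ : V → Set} {a C} → (∀ p → P p → P′ p) → _∶_⇉_ S P a C → _∶_⇉_ S P′ a C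
  ⇉-map P⇒P′ total x x∈a = let (y , y∈C , xy) = total x x∈a in y , y∈C , pairMember-map P⇒P′ xy

  regular-⇆ : ∀ {A a} {P : V → Set} → IsRegular S A → a ∈ A → Definable P → _∶_⇉_ S P a A →
    Σ V λ b → b ∈ A × _∶_⇆_ S P a b
  regular-⇆ (_ , A-regular) a∈A (_ , φ , ρ , φ⇔P) total with A-regular _ a∈A φ ρ (⇉-map (λ p → proj₂ (φ⇔P p)) total)
  ... | b , b∈A , b-total , b-onto = b , b∈A , ⇉-map (λ p → proj₁ (φ⇔P p)) b-total ,
    λ y y∈b → let (x , x∈a , xy) = b-onto y y∈b in x , x∈a , pairMember-map (λ p → proj₁ (φ⇔P p)) xy

  ≈-iffʳ : ∀ {x y} w → x ≈ y → (w ≈ x) iff (w ≈ y)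
  ≈-iffʳ w e = (λ d → ≈-trans d e) , (λ d → ≈-trans d (≈-sym e))

  ∈-iffʳ : ∀ {x y} w → x ≈ y → (w ∈ x) iff (w ∈ y)
  ∈-iffʳ w e = ∈-congʳ e , ∈-congʳ (≈-sym e)

  IsPair-cong : ∀ {p p′ x x′ y y′} → p ≈ p′ → x ≈ x′ → y ≈ y′ → IsPair S p x y iff IsPair S p′ x′ y′
  IsPair-cong p≈ x≈ y≈ = ∀-iff λ z → ∈-iffʳ z p≈ ⇔-iff
    (∀-iff (λ w → iff-refl ⇔-iff ≈-iffʳ w x≈) ⊎-iff ∀-iff (λ w → iff-refl ⇔-iff (≈-iffʳ w x≈ ⊎-iff ≈-iffʳ w y≈)))

  pairMember-cong : ∀ {x x′ y y′} {P : V → Set} → x ≈ x′ → y ≈ y′ → ⟨_,_⟩∈ S x y P → ⟨_,_⟩∈ S x′ y′ P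
  pairMember-cong x≈ y≈ (q , q-pair , qP) = q , proj₁ (IsPair-cong ≈-refl x≈ y≈) q-pair , qP

  IsUnionOf-cong : ∀ {P P′ z z′} → (∀ y → P y iff P′ y) → z ≈ z′ → IsUnionOf P z → IsUnionOf P′ z′
  IsUnionOf-cong P⇔P′ z≈z′ z-union w =
    iff-trans (∈-iffʳ w (≈-sym z≈z′)) (iff-trans (z-union w) (Σ-iff λ y → P⇔P′ y ×-iff iff-refl))

  module WithExtensionality (ext : Extensionality S (Universe S)) where

    ≈-by-members : ∀ {x y} {P : V → Set} → ((w : V) → w ∈ x iff P w) → ((w : V) → w ∈ y iff P w) → x ≈ y
    ≈-by-members {x} {y} hx hy = ext x y tt tt λ w _ → iff-trans (hx w) (iff-sym (hy w))

    ≈-iff-members : ∀ {z c} {P : V → Set} → ((w : V) → w ∈ c iff P w) → (z ≈ c) iff ((w : V) → w ∈ z iff P w)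
    ≈-iff-members c-members = (λ z≈c w → iff-trans (∈-iffʳ w z≈c) (c-members w))
                            , (λ z-members → ≈-by-members z-members c-members)

    IsUnorderedPair-diagonal : ∀ {c x} → IsUnorderedPair c x x → IsSingleton c x
    IsUnorderedPair-diagonal c-pair w = iff-trans (c-pair w) (reduce , inj₁)

    IsPair-from : ∀ {p s d x y} → IsUnorderedPair p s d → IsUnorderedPair s x x → IsUnorderedPair d x y → IsPair S p x y
    IsPair-from p-pair s-pair d-pair z =
      iff-trans (p-pair z) (≈-iff-members (IsUnorderedPair-diagonal s-pair) ⊎-iff ≈-iff-members d-pair)

    IsUnionOf-unique : ∀ {P P′ z z′} → (∀ y → P y iff P′ y) → IsUnionOf P z → IsUnionOf P′ z′ → z ≈ z′
    IsUnionOf-unique P⇔P′ z-union z′-union = ≈-by-members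
      (λ w → iff-trans (z-union w) (Σ-iff λ y → P⇔P′ y ×-iff iff-refl)) z′-union

    module WithPairing (pairing : Pairing S (Universe S)) where

      unorderedPair : (x y : V) → Σ V λ c → IsUnorderedPair c x y
      unorderedPair x y with pairing x y tt tt
      ... | c , _ , c-pair = c , λ w → c-pair w tt

      singleton : (x : V) → Σ V λ c → IsSingleton c x
      singleton x with unorderedPair x x
      ... | c , c-pair = c , IsUnorderedPair-diagonal c-pair

      IsPair-first∈ : ∀ {p x y z} → IsPair S p x y → z ∈ p → x ∈ z
      IsPair-first∈ p-pair z∈p with proj₁ (p-pair _) z∈p
      ... | inj₁ z-sing = proj₂ (z-sing _) ≈-refl
      ... | inj₂ z-upair = proj₂ (z-upair _) (inj₁ ≈-refl)

      IsPair-∈∈ : ∀ {p x y z w} → IsPair S p x y → z ∈ p → w ∈ z → w ≈ x ⊎ w ≈ y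
      IsPair-∈∈ p-pair z∈p w∈z with proj₁ (p-pair _) z∈p
      ... | inj₁ z-sing = inj₁ (proj₁ (z-sing _) w∈z)
      ... | inj₂ z-upair = proj₁ (z-upair _) w∈z

      IsPair-injective : ∀ {p x y x′ y′} → IsPair S p x y → IsPair S p x′ y′ → x ≈ x′ × y ≈ y′
      IsPair-injective {p} {x} {y} {x′} {y′} h h′ = x≈x′ , y≈y′
        where
        s = proj₁ (singleton x)
        d = proj₁ (unorderedPair x y)
        d′ = proj₁ (unorderedPair x′ y′)
        x≈x′ : x ≈ x′
        x≈x′ = ≈-sym (proj₁ (proj₂ (singleton x) x′) (IsPair-first∈ h′ (proj₂ (h s) (inj₁ (proj₂ (singleton x))))))
        y∈d : y ∈ d
        y∈d = proj₂ (proj₂ (unorderedPair x y) y) (inj₂ ≈-refl)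
        y′∈d′ : y′ ∈ d′
        y′∈d′ = proj₂ (proj₂ (unorderedPair x′ y′) y′) (inj₂ ≈-refl)
        y≈y′ : y ≈ y′
        y≈y′ with IsPair-∈∈ h′ (proj₂ (h d) (inj₂ (proj₂ (unorderedPair x y)))) y∈d
                | IsPair-∈∈ h (proj₂ (h′ d′) (inj₂ (proj₂ (unorderedPair x′ y′)))) y′∈d′
        ... | inj₂ y≈y′ | _ = y≈y′
        ... | inj₁ _ | inj₂ y′≈y = ≈-sym y′≈y
        ... | inj₁ y≈x′ | inj₁ y′≈x = ≈-trans y≈x′ (≈-trans (≈-sym x≈x′) (≈-sym y′≈x))

      IsPair-unique : ∀ {p q x y} → IsPair S p x y → IsPair S q x y → p ≈ q
      IsPair-unique p-pair q-pair = ≈-by-members p-pair q-pair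

      module _ {M : V → Set} (M-trans : ∀ {u v} → M u → v ∈ u → M v) (M-resp : ∀ {u v} → u ≈ v → M u → M v)
               (M-pairing : Pairing S M) where

        unorderedPair-∈ : ∀ {x y} → M x → M y → Σ V λ c → M c × IsUnorderedPair c x y
        unorderedPair-∈ {x} {y} Mx My with M-pairing x y Mx My
        ... | c , Mc , c-pair = c , Mc , λ w → (λ w∈c → proj₁ (c-pair w (M-trans Mc w∈c)) w∈c)
                                             , (λ w≈ → proj₂ (c-pair w (M-member w≈)) w≈)
          where
          M-member : ∀ {w} → w ≈ x ⊎ w ≈ y → M w
          M-member (inj₁ w≈x) = M-resp (≈-sym w≈x) Mx
          M-member (inj₂ w≈y) = M-resp (≈-sym w≈y) My

        pair-∈ : ∀ {x y} → M x → M y → Σ V λ p → M p × IsPair S p x y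
        pair-∈ Mx My with unorderedPair-∈ Mx Mx | unorderedPair-∈ Mx My
        ... | s , Ms , s-pair | d , Md , d-pair with unorderedPair-∈ Ms Md
        ... | p , Mp , p-pair = p , Mp , IsPair-from p-pair s-pair d-pair

      pair : (x y : V) → Σ V λ p → IsPair S p x y
      pair x y with pair-∈ {Universe S} _ _ pairing {x} {y} tt tt
      ... | p , _ , p-pair = p , p-pair

      ∈GraphOf⇒ : ∀ {φ x y} → Respects₂ φ → ⟨_,_⟩∈ S x y (GraphOf φ) → φ x y
      ∈GraphOf⇒ φ-resp (p , p-pair , x′ , y′ , p-pair′ , φx′y′) with IsPair-injective p-pair p-pair′
      ... | x≈x′ , y≈y′ = φ-resp (≈-sym x≈x′) (≈-sym y≈y′) φx′y′

      ∈GraphOf⇐ : ∀ {φ x y} → φ x y → ⟨_,_⟩∈ S x y (GraphOf φ)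
      ∈GraphOf⇐ {x = x} {y} φxy with pair x y
      ... | p , p-pair = p , p-pair , x , y , p-pair , φxy

      IsSep-resp : ∀ {P : V → Set} → (∀ {y y′} → y ≈ y′ → P y → P y′) → Respects₂ (λ y u → IsSep y (P y) u)
      IsSep-resp P-resp y≈y′ u≈u′ u-sep v =
        iff-trans (∈-iffʳ v (≈-sym u≈u′)) (iff-trans (u-sep v) (∈-iffʳ v y≈y′ ×-iff (P-resp y≈y′ , P-resp (≈-sym y≈y′))))

      ⋃-restrictions : ∀ {P : V → Set} {b c z} → (∀ {y y′} → y ≈ y′ → P y → P y′) →
        _∶_⇆_ S (GraphOf (λ y u → IsSep y (P y) u)) b c → IsUnionOf (_∈ c) z → IsUnionOf (λ y → y ∈ b × P y) z
      ⋃-restrictions {P} {b} {c} P-resp (c-total , c-onto) z-union w = iff-trans (z-union w) (sound , complete)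
        where
        restriction : ∀ {y k} → ⟨_,_⟩∈ S y k (GraphOf (λ y u → IsSep y (P y) u)) → IsSep y (P y) k
        restriction = ∈GraphOf⇒ (IsSep-resp P-resp)
        sound : (Σ V λ k → k ∈ c × w ∈ k) → Σ V λ y → (y ∈ b × P y) × w ∈ y
        sound (k , k∈c , w∈k) with c-onto k k∈c
        ... | y , y∈b , yk with proj₁ (restriction yk w) w∈k
        ... | w∈y , Py = y , (y∈b , Py) , w∈y
        complete : (Σ V λ y → (y ∈ b × P y) × w ∈ y) → Σ V λ k → k ∈ c × w ∈ k
        complete (y , (y∈b , Py) , w∈y) with c-total y y∈b
        ... | k , k∈c , yk = k , k∈c , proj₂ (restriction yk w) (w∈y , Py)

      module _ {A : V} (A-trans : IsTransitive S A) where

        private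
          inA : ∀ {u v} → u ∈ A → v ∈ u → v ∈ A
          inA u∈A v∈u = A-trans _ u∈A _ v∈u

        union-∈ : Union S (_∈ A) → ∀ {c} → c ∈ A → Σ V λ z → z ∈ A × IsUnionOf (_∈ c) z
        union-∈ A-union c∈A with A-union _ c∈A
        ... | z , z∈A , z-union = z , z∈A , λ w →
          (λ w∈z → let (k , _ , k∈c , w∈k) = proj₁ (z-union w (inA z∈A w∈z)) w∈z in k , k∈c , w∈k) ,
          (λ (k , k∈c , w∈k) → proj₂ (z-union w (inA (inA c∈A k∈c) w∈k)) (k , inA c∈A k∈c , k∈c , w∈k))

        sepInhabited-∈ : Δ₀-Separation S (_∈ A) → ∀ {t y} → t ∈ A → y ∈ A → Σ V λ u → u ∈ A × IsSep y (Inhabited t) u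
        sepInhabited-∈ A-sep {t} {y} t∈A y∈A with A-sep (bex (# 1) (eq (# 0) (# 0))) (bex (# 1) (eq (# 0) (# 0)))
                                                   (t ∷ []) (λ { zero → t∈A }) y y∈A
        ... | u , u∈A , u-sep = u , u∈A , λ v →
          (λ v∈u → let (v∈y , e , _ , e∈t , _) = proj₁ (u-sep v (inA u∈A v∈u)) v∈u in v∈y , e , e∈t) ,
          (λ (v∈y , e , e∈t) → proj₂ (u-sep v (inA y∈A v∈y)) (v∈y , e , inA t∈A e∈t , e∈t , ≈-refl))

        truthValue-∈ : Pairing S (_∈ A) → Emptyset S (_∈ A) → Δ₀-Separation S (_∈ A) →
          ∀ {x y R} → x ∈ A → y ∈ A → R ∈ A →
          Σ V λ t → t ∈ A × (⊆1 S t × (Inhabited t iff ⟨_,_⟩∈ S x y (_∈ R)))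
        truthValue-∈ A-pairing (e , e∈A , e-empty) A-sep {x} {y} {R} x∈A y∈A R∈A
          with unorderedPair-∈ inA ∈-congˡ A-pairing e∈A e∈A | pair-∈ inA ∈-congˡ A-pairing x∈A y∈A
        ... | one , one∈A , one-pair | p , p∈A , p-pair
          -- t = {e ∈ one ∣ ∃ q ∈ R. q = p}
          with A-sep (bex (# 1) (eq (# 0) (# 3))) (bex (# 1) (eq (# 0) (# 3)))
                     (R ∷ p ∷ []) (λ { zero → R∈A ; (suc zero) → p∈A }) one one∈A
        ... | t , t∈A , t-sep = t , t∈A , t⊆1 , sound , complete
          where
          t⊆1 : ⊆1 S t
          t⊆1 z z∈t w w∈z with proj₁ (one-pair z) (proj₁ (proj₁ (t-sep z (inA t∈A z∈t)) z∈t))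
          ... | z≈e≈e = let w∈e = ∈-congʳ (reduce z≈e≈e) w∈z in e-empty w (inA e∈A w∈e) w∈e
          sound : Inhabited t → ⟨_,_⟩∈ S x y (_∈ R)
          sound (z , z∈t) with proj₂ (proj₁ (t-sep z (inA t∈A z∈t)) z∈t)
          ... | q , _ , q∈R , q≈p = q , proj₂ (IsPair-cong q≈p ≈-refl ≈-refl) p-pair , q∈R
          complete : ⟨_,_⟩∈ S x y (_∈ R) → Inhabited t
          complete (q , q-pair , q∈R) =
            e , proj₂ (t-sep e e∈A) (proj₂ (one-pair e) (inj₁ ≈-refl) , q , inA R∈A q∈R , q∈R , IsPair-unique q-pair p-pair)

module _ (S : Structure) where
  open Structure S
  open SetTheory S

  module Selection (ext : Extensionality S (Universe S)) (pairing : Pairing S (Universe S))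
           {A : V} (A-regular : IsRegular S A) (A-pairing : Pairing S (_∈ A)) (A-union : Union S (_∈ A))
           (A-sep : Δ₀-Separation S (_∈ A))
           {B : V} (B-trans : IsTransitive S B) (B-pairing : Pairing S (_∈ B)) (B-empty : Emptyset S (_∈ B))
           (B-sep : Δ₀-Separation S (_∈ B))
           (A∈B : A ∈ B) (𝒫1-agree : (t : V) → (⊆1 S t × t ∈ A) iff (⊆1 S t × t ∈ B))
           {a R Q : V} (a∈A : a ∈ A) (R∈B : R ∈ B)
           (R⊆Q : (x y : V) → ⟨_,_⟩∈ S x y (_∈ R) → (w : V) → w ∈ y → ⟨_,_⟩∈ S x w (_∈ Q))
           (R-closed : (x y z : V) → ⟨_,_⟩∈ S x y (_∈ R) → _⊆_ S y z →
             ((w : V) → w ∈ z → ⟨_,_⟩∈ S x w (_∈ Q)) → ⟨_,_⟩∈ S x z (_∈ R)) where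

    open WithExtensionality ext
    open WithPairing pairing

    private
      A-trans : IsTransitive S A
      A-trans = proj₁ A-regular

      inA : ∀ {u v} → u ∈ A → v ∈ u → v ∈ A
      inA u∈A v∈u = A-trans _ u∈A _ v∈u

      A⊆B : ∀ {u} → u ∈ A → u ∈ B
      A⊆B u∈A = B-trans _ A∈B _ u∈A

    InR : V → V → Set
    InR x y = ⟨_,_⟩∈ S x y (_∈ R)

    InR-respʳ : ∀ {x y y′} → y ≈ y′ → InR x y → InR x y′
    InR-respʳ = pairMember-cong ≈-refl

    restriction-∈A : ∀ {x y} → x ∈ A → y ∈ A → Σ V λ u → u ∈ A × IsSep y (InR x y) u
    restriction-∈A x∈A y∈A =
      let t , t∈B , t⊆1 , t⇔xy∈R = truthValue-∈ B-trans B-pairing B-empty B-sep (A⊆B x∈A) (A⊆B y∈A) R∈B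
          t∈A = proj₂ (proj₂ (𝒫1-agree t) (t⊆1 , t∈B))
          u , u∈A , u-sep = sepInhabited-∈ A-trans A-sep t∈A y∈A
      in u , u∈A , λ v → iff-trans (u-sep v) (iff-refl ×-iff t⇔xy∈R)

    -- de Bruijn context: p, x, R
    restrictionGraphᶠ : Fm 3
    restrictionGraphᶠ = ex (ex (and (isPairᶠ (# 2) (# 1) (# 0))
      (all (mem (# 0) (# 1) ⇔ᶠ and (mem (# 0) (# 2)) (pairMemᶠ (# 5) (# 4) (# 2))))))

    restrictionGraph-definable : (x : V) → Definable (GraphOf λ y u → IsSep y (InR x y) u)
    restrictionGraph-definable x = 2 , restrictionGraphᶠ , x ∷ R ∷ [] , λ p →
      Σ⊤-iff λ y → Σ⊤-iff λ u → sat-isPairᶠ (# 2) (# 1) (# 0) (u ∷ y ∷ p ∷ x ∷ R ∷ []) ×-iff ∀⊤-iff λ v →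
        iff-refl ⇔-iff (iff-refl ×-iff sat-pairMemᶠ (# 5) (# 4) (# 2) (v ∷ u ∷ y ∷ p ∷ x ∷ R ∷ []))

    module _ {b : V} (b∈A : b ∈ A) (b-total : _∶_⇉_ S (_∈ R) a b) where

      Fiber : V → V → Set
      Fiber x y = y ∈ b × InR x y

      Fiber-cong : ∀ {x x′} → x ≈ x′ → (y : V) → Fiber x y iff Fiber x′ y
      Fiber-cong x≈x′ y = iff-refl ×-iff (pairMember-cong x≈x′ ≈-refl , pairMember-cong (≈-sym x≈x′) ≈-refl)

      fiberUnion-∈A : ∀ {x} → x ∈ A → Σ V λ z → z ∈ A × IsUnionOf (Fiber x) z
      fiberUnion-∈A {x} x∈A =
        let c , c∈A , c-graph = regular-⇆ A-regular b∈A (restrictionGraph-definable x) restrictions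
            z , z∈A , z-union = union-∈ A-trans A-union c∈A
        in z , z∈A , ⋃-restrictions InR-respʳ c-graph z-union
        where
        restrictions : _∶_⇉_ S (GraphOf λ y u → IsSep y (InR x y) u) b A
        restrictions y y∈b = let u , u∈A , u-sep = restriction-∈A x∈A (inA b∈A y∈b)
                             in u , u∈A , ∈GraphOf⇐ u-sep

      fiberUnion-∈R : ∀ {x z} → x ∈ a → IsUnionOf (Fiber x) z → InR x z
      fiberUnion-∈R {x} {z} x∈a z-union =
        let y , y∈b , xy∈R = b-total x x∈a
        in R-closed x y z xy∈R (λ w w∈y → proj₂ (z-union w) (y , (y∈b , xy∈R) , w∈y)) z⊆Qₓ
        where
        z⊆Qₓ : (w : V) → w ∈ z → ⟨_,_⟩∈ S x w (_∈ Q)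
        z⊆Qₓ w w∈z = let y , (_ , xy∈R) , w∈y = proj₁ (z-union w) w∈z in R⊆Q x y xy∈R w w∈y

      IsFiberUnionPair : V → V → Set
      IsFiberUnionPair x q = Σ V λ z → IsPair S q x z × (z ∈ A × IsUnionOf (Fiber x) z)

      IsFiberUnionPair-resp : Respects₂ IsFiberUnionPair
      IsFiberUnionPair-resp x≈x′ q≈q′ (z , q-pair , z∈A , z-union) =
        z , proj₁ (IsPair-cong q≈q′ x≈x′ ≈-refl) q-pair , z∈A , IsUnionOf-cong (Fiber-cong x≈x′) ≈-refl z-union

      -- de Bruijn context: p, A, R, b
      fiberUnionGraphᶠ : Fm 4
      fiberUnionGraphᶠ = ex (ex (and (isPairᶠ (# 2) (# 1) (# 0)) (ex (and (isPairᶠ (# 1) (# 2) (# 0))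
        (and (mem (# 0) (# 4)) (all (mem (# 0) (# 1) ⇔ᶠ
          ex (and (and (mem (# 0) (# 8)) (pairMemᶠ (# 7) (# 4) (# 0))) (mem (# 1) (# 0))))))))))

      fiberUnionGraph-definable : Definable (GraphOf IsFiberUnionPair)
      fiberUnionGraph-definable = 3 , fiberUnionGraphᶠ , A ∷ R ∷ b ∷ [] , λ p →
        Σ⊤-iff λ x → Σ⊤-iff λ q → sat-isPairᶠ (# 2) (# 1) (# 0) (q ∷ x ∷ p ∷ A ∷ R ∷ b ∷ []) ×-iff Σ⊤-iff λ z →
          sat-isPairᶠ (# 1) (# 2) (# 0) (z ∷ q ∷ x ∷ p ∷ A ∷ R ∷ b ∷ []) ×-iff (iff-refl ×-iff ∀⊤-iff λ w →
            iff-refl ⇔-iff Σ⊤-iff λ y →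
              (iff-refl ×-iff sat-pairMemᶠ (# 7) (# 4) (# 0) (y ∷ w ∷ z ∷ q ∷ x ∷ p ∷ A ∷ R ∷ b ∷ [])) ×-iff iff-refl)

      fiberUnionGraph-∈A : Σ V λ f → f ∈ A × _∶_⇆_ S (GraphOf IsFiberUnionPair) a f
      fiberUnionGraph-∈A = regular-⇆ A-regular a∈A fiberUnionGraph-definable λ x x∈a →
        let z , z∈A , z-union = fiberUnion-∈A (inA a∈A x∈a)
            q , q∈A , q-pair = pair-∈ inA ∈-congˡ A-pairing (inA a∈A x∈a) z∈A
        in q , q∈A , ∈GraphOf⇐ (z , q-pair , z∈A , z-union)

      module _ {f : V} (f-graph : _∶_⇆_ S (GraphOf IsFiberUnionPair) a f) where

        ∈f⇒fiberUnion : ∀ {x y} → ⟨_,_⟩∈ S x y (_∈ f) → x ∈ a × (y ∈ A × IsUnionOf (Fiber x) y)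
        ∈f⇒fiberUnion (q , q-pair , q∈f) =
          let x′ , x′∈a , x′q = proj₂ f-graph q q∈f
              z , q-pair′ , z∈A , z-union = ∈GraphOf⇒ IsFiberUnionPair-resp x′q
              x≈x′ , y≈z = IsPair-injective q-pair q-pair′
          in ∈-congˡ (≈-sym x≈x′) x′∈a , ∈-congˡ (≈-sym y≈z) z∈A ,
             IsUnionOf-cong (Fiber-cong (≈-sym x≈x′)) (≈-sym y≈z) z-union

        f-IsFunction : IsFunction S f a A
        f-IsFunction = f⊆a×A , f-total , f-functional
          where
          f⊆a×A : ⊆× S f a A
          f⊆a×A q q∈f = let x , x∈a , xq = proj₂ f-graph q q∈f
                            z , q-pair , z∈A , _ = ∈GraphOf⇒ IsFiberUnionPair-resp xq
                        in x , x∈a , z , z∈A , q-pair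
          f-total : (x : V) → x ∈ a → Σ V λ y → ⟨_,_⟩∈ S x y (_∈ f)
          f-total x x∈a = let q , q∈f , xq = proj₁ f-graph x x∈a
                              z , q-pair , _ = ∈GraphOf⇒ IsFiberUnionPair-resp xq
                          in z , q , q-pair , q∈f
          f-functional : (x y y′ : V) → ⟨_,_⟩∈ S x y (_∈ f) → ⟨_,_⟩∈ S x y′ (_∈ f) → y ≈ y′
          f-functional x y y′ xy∈f xy′∈f = IsUnionOf-unique (λ _ → iff-refl)
            (proj₂ (proj₂ (∈f⇒fiberUnion xy∈f))) (proj₂ (proj₂ (∈f⇒fiberUnion xy′∈f)))

        f⊆R : (x y : V) → ⟨_,_⟩∈ S x y (_∈ f) → InR x y
        f⊆R x y xy∈f = let x∈a , _ , y-union = ∈f⇒fiberUnion xy∈f in fiberUnion-∈R x∈a y-union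

lemma6p2 : (S : Structure) → let open Structure S in
    CZF⁻ S (Universe S) →
    (A B : V) → A ∈ B →
    ((x : V) → (⊆1 S x × x ∈ A) iff (⊆1 S x × x ∈ B)) →
    IsBCSTRegular S A → IsTransitiveModelOfCZF⁻ S B →
    (a : V) → a ∈ A →
    (R : V) → R ∈ B → _∶_⇉_ S (mem[_] S R) a A →
    (Q : V) → ⊆× S Q a A → Q ∈ B →
    ((x y : V) → ⟨_,_⟩∈ S x y (mem[_] S R) →
      (w : V) → w ∈ y → ⟨_,_⟩∈ S x w (mem[_] S Q)) →
    ((x y z : V) → ⟨_,_⟩∈ S x y (mem[_] S R) → _⊆_ S y z →
      ((w : V) → w ∈ z → ⟨_,_⟩∈ S x w (mem[_] S Q)) →
      ⟨_,_⟩∈ S x z (mem[_] S R)) →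
    Σ V λ f → f ∈ A × (IsFunction S f a A ×
      ((x y : V) → x ∈ a → ⟨_,_⟩∈ S x y (mem[_] S f) → ⟨_,_⟩∈ S x y (mem[_] S R)))
lemma6p2 S ((ext , pairing , _) , _) A B A∈B 𝒫1-agree
         (A-regular , ((_ , A-pairing , A-union , _) , (_ , A-sep)))
         (B-trans , ((_ , B-pairing , _ , B-empty , _) , (_ , B-sep , _)))
         a a∈A R R∈B R-total Q _ _ R⊆Q R-closed =
  let b , b∈A , b-total , _ = regular-⇆ A-regular a∈A (mem-definable R) R-total
      f , f∈A , f-graph = fiberUnionGraph-∈A b∈A b-total
  in f , f∈A , f-IsFunction b∈A b-total f-graph , λ x y _ → f⊆R b∈A b-total f-graph x y
  where
  open SetTheory S
  open Selection S ext pairing A-regular A-pairing A-union A-sep B-trans B-pairing B-empty B-sep A∈B 𝒫1-agree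
    a∈A R∈B R⊆Q R-closed
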